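{- For $n\ge2$, \[\big\|\mathbb G_n-\mathrm{Unif}(\mathcal G_n)\big\|_{\mathrm{TV}}=\frac{n(2^n-n-1)}{2^n(2^n-n)}\le\frac{n}{2^n}.\]
   Context: $\mathcal G_n$ is the set of Grassmannian permutations in $S_n$ (at most one descent); $|\mathcal G_n|=2^n-n$. The distribution $\mathbb G_n$ on $\mathcal G_n$: choose $V\subseteq[n]$ uniformly among all $2^n$ subsets, set $k=|V|$, and output the permutation whose first $k$ values are the elements of $V$ in increasing order and whose remaining values are the elements of $[n]\setminus V$ in increasing order. For probability measures $\mu,\nu$ on a finite set $\Omega$, $\|\mu-\nu\|_{\mathrm{TV}}=\frac12\sum_{x\in\Omega}|\mu(\{x\})-\nu(\{x\})|$. -}

module Defs where

open import Data.Nat as ℕ using (ℕ; zero; suc; _∸_; _^_; _<ᵇ_)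
open import Data.Bool using (Bool; true; false; if_then_else_)
open import Data.List using (List; []; _∷_; _++_; map; concatMap; filter; length; foldr; upTo)
open import Data.List.Properties using (≡-dec)
open import Data.List.Membership.DecPropositional ℕ._≟_ using (_∈?_)
open import Data.List.Relation.Unary.All using (all?)
open import Data.Integer using (+_)
open import Data.Rational using (ℚ; _/_; 0ℚ; _+_; _-_; _*_; ∣_∣; ½)
open import Relation.Nullary.Decidable using (Dec; yes; no; _×-dec_)
open import Relation.Binary.PropositionalEquality using (_≡_)
open import Data.Product using (_×_; _,_)

range : ℕ → List ℕ
range n = map suc (upTo n)

words : ℕ → List ℕ → List (List ℕ)
words zero    xs = [] ∷ []
words (suc k) xs = concatMap (λ x → map (x ∷_) (words k xs)) xs

-- a word of length n over [n] is a permutation (one-line notation)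
-- iff every element of [n] occurs in it
IsPerm : ℕ → List ℕ → Set
IsPerm n w = Data.List.Relation.Unary.All.All (λ i → Data.List.Membership.Propositional._∈_ i w) (range n)
  where import Data.List.Membership.Propositional

isPerm? : ∀ n w → Dec (IsPerm n w)
isPerm? n w = all? (λ i → i ∈? w) (range n)

Sn : ℕ → List (List ℕ)
Sn n = filter (isPerm? n) (words n (range n))

des : List ℕ → ℕ
des []           = 0
des (x ∷ [])     = 0
des (x ∷ y ∷ ws) = (if y <ᵇ x then 1 else 0) ℕ.+ des (y ∷ ws)

grass? : (w : List ℕ) → Dec (des w ℕ.≤ 1)
grass? w = des w ℕ.≤? 1

Gn : ℕ → List (List ℕ)
Gn n = filter grass? (Sn n)

-- all subsets V ⊆ [n], encoded as indicator lists (entry i ↔ i+1 ∈ V)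
subsets : ℕ → List (List Bool)
subsets zero    = [] ∷ []
subsets (suc n) = concatMap (λ b → map (b ∷_) (subsets n)) (true ∷ false ∷ [])

selectFrom : ℕ → List Bool → List ℕ × List ℕ
selectFrom i []          = [] , []
selectFrom i (b ∷ bs) with selectFrom (suc i) bs
... | (ys , zs) = if b then (i ∷ ys , zs) else (ys , i ∷ zs)

grassOf : List Bool → List ℕ
grassOf bs with selectFrom 1 bs
... | (ys , zs) = ys ++ zs

-- fraction a / d (only used with d > 0)
frac : ℕ → ℕ → ℚ
frac a zero    = 0ℚ
frac a (suc d) = (+ a) / suc d

Gdist : ℕ → List ℕ → ℚ
Gdist n w = frac (length (filter (λ V → ≡-dec ℕ._≟_ (grassOf V) w) (subsets n))) (2 ^ n)

Unif : ℕ → List ℕ → ℚ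
Unif n w with Data.List.Relation.Unary.Any.any? (λ v → ≡-dec ℕ._≟_ v w) (Gn n)
  where import Data.List.Relation.Unary.Any
... | yes _ = frac 1 (length (Gn n))
... | no  _ = 0ℚ

sumℚ : List ℚ → ℚ
sumℚ = foldr _+_ 0ℚ

TV : (ℕ → List ℕ → ℚ) → (ℕ → List ℕ → ℚ) → ℕ → ℚ
TV μ ν n = ½ * sumℚ (map (λ x → ∣ μ n x - ν n x ∣) (Sn n))

-- Write mult n w for the number of subsets V ⊆ [n] with grassOf V = w, so that 𝔾_n({w}) = mult n w / 2^n.
-- The identity arises from the n + 1 initial segments {1, …, k}; every other Grassmannian permutation w
-- arises exactly once, from the set of values before its descent; a permutation with two or more descents
-- does not arise at all.  As mult sums to 2^n over S_n, N := |𝒢_n| = 2^n − n.  Over the common denominator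
-- 2^n N, the error |𝔾_n({w}) − Unif(w)| is n (N − 1) at the identity and n at each of the other N − 1
-- Grassmannian permutations, so the distance is ½ · 2 n (N − 1) / (2^n N); the bound is N − 1 ≤ N.
module Submission where

open import Defs
import Data.Bool as Bool
open Bool using (Bool; true; false; if_then_else_; T)
open import Data.Empty using (⊥-elim)
open import Data.List using (List; []; _∷_; _++_; map; concat; filter; length; replicate; applyUpTo)
open import Data.List.Properties
  using (≡-dec; ∷-injectiveˡ; ∷-injectiveʳ; length-++; length-map; length-replicate; map-upTo; map-cong-local;
         filter-accept; filter-reject)
open import Data.List.Membership.Propositional using (_∈_; _∉_)
open import Data.List.Membership.Propositional.Properties
  using (∈-++⁺ˡ; ∈-++⁺ʳ; ∈-++⁻; ∈-filter⁺; ∈-filter⁻)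
open import Data.List.Relation.Unary.All as All using (All; []; _∷_)
import Data.List.Relation.Unary.All.Properties as All
open import Data.List.Relation.Unary.Any as Any using (here; there)
open import Data.List.Relation.Unary.Linked as Linked using (Linked; []; [-]; _∷_)
open import Data.List.Relation.Unary.Linked.Properties using (Linked⇒All)
open import Data.Nat as ℕ using (ℕ; zero; suc; _+_; _*_; _∸_; _^_; _≤_; _<_; z≤n; s≤s; _<ᵇ_; ∣_-_∣)
import Data.Nat.Properties as ℕₚ
open import Data.List.Membership.DecPropositional ℕ._≟_ using (_∈?_)
open import Data.Nat.Solver using (module +-*-Solver)
import Data.Integer as ℤ
import Data.Integer.Properties as ℤₚ
open import Data.Rational as ℚ using (0ℚ; ½; ∣_∣)
  renaming (_+_ to _+ℚ_; _-_ to _-ℚ_; _*_ to _*ℚ_; _≤_ to _≤ℚ_)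
import Data.Rational.Properties as ℚₚ
open import Data.Rational.Unnormalised as ℚᵘ using (mkℚᵘ; *≡*; *≤*)
import Data.Rational.Unnormalised.Properties as ℚᵘₚ
import Algebra.Properties.Group ℚₚ.+-0-group as ℚ-group
open import Data.Product as Product using (_×_; _,_; proj₁; proj₂; ∃)
open import Data.Sum using (_⊎_; inj₁; inj₂)
open import Function using (_∘_; _⇔_; mk⇔; Equivalence)
open import Relation.Binary using (DecidableEquality)
open import Relation.Binary.PropositionalEquality
open import Relation.Nullary using (Dec; yes; no; ¬_; does; contradiction)
open import Relation.Unary.Properties using (∁?)
open import Relation.Nullary.Decidable using (dec-true; dec-false; does-⇔; _×-dec_)

open +-*-Solver using (solve; _:=_; _:+_; _:*_; con)

private
  variable
    A B : Set
    P Q : Set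

-- Sums and counting

∑ : (A → ℕ) → List A → ℕ
∑ f []       = 0
∑ f (x ∷ xs) = f x + ∑ f xs

∑-++ : (f : A → ℕ) (xs ys : List A) → ∑ f (xs ++ ys) ≡ ∑ f xs + ∑ f ys
∑-++ f []       ys = refl
∑-++ f (x ∷ xs) ys = trans (cong (f x +_) (∑-++ f xs ys)) (sym (ℕₚ.+-assoc (f x) _ _))

∑-map : (f : B → ℕ) (g : A → B) (xs : List A) → ∑ f (map g xs) ≡ ∑ (f ∘ g) xs
∑-map f g []       = refl
∑-map f g (x ∷ xs) = cong (f (g x) +_) (∑-map f g xs)

∑-concat : (f : A → ℕ) (xss : List (List A)) → ∑ f (concat xss) ≡ ∑ (∑ f) xss
∑-concat f []         = refl
∑-concat f (xs ∷ xss) = trans (∑-++ f xs (concat xss)) (cong (∑ f xs +_) (∑-concat f xss))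

∑-cong : {f g : A → ℕ} → (∀ x → f x ≡ g x) → (xs : List A) → ∑ f xs ≡ ∑ g xs
∑-cong f≗g []       = refl
∑-cong f≗g (x ∷ xs) = cong₂ _+_ (f≗g x) (∑-cong f≗g xs)

∑-cong-All : {f g : A → ℕ} {xs : List A} → All (λ x → f x ≡ g x) xs → ∑ f xs ≡ ∑ g xs
∑-cong-All []         = refl
∑-cong-All (e ∷ es) = cong₂ _+_ e (∑-cong-All es)

∑-mono-All : {f g : A → ℕ} {xs : List A} → All (λ x → f x ≤ g x) xs → ∑ f xs ≤ ∑ g xs
∑-mono-All []         = z≤n
∑-mono-All (le ∷ les) = ℕₚ.+-mono-≤ le (∑-mono-All les)

∑-zero : (xs : List A) → ∑ (λ _ → 0) xs ≡ 0
∑-zero []       = refl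
∑-zero (_ ∷ xs) = ∑-zero xs

∑-+ : (f g : A → ℕ) (xs : List A) → ∑ (λ x → f x + g x) xs ≡ ∑ f xs + ∑ g xs
∑-+ f g []       = refl
∑-+ f g (x ∷ xs) = trans (cong (f x + g x +_) (∑-+ f g xs))
  (solve 4 (λ a b c d → (a :+ b) :+ (c :+ d) := (a :+ c) :+ (b :+ d)) refl (f x) (g x) (∑ f xs) (∑ g xs))

∑-*ʳ : (f : A → ℕ) (k : ℕ) (xs : List A) → ∑ (λ x → f x * k) xs ≡ ∑ f xs * k
∑-*ʳ f k []       = refl
∑-*ʳ f k (x ∷ xs) = trans (cong (f x * k +_) (∑-*ʳ f k xs)) (sym (ℕₚ.*-distribʳ-+ k (f x) (∑ f xs)))

∑-*ˡ : (k : ℕ) (f : A → ℕ) (xs : List A) → ∑ (λ x → k * f x) xs ≡ k * ∑ f xs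
∑-*ˡ k f xs = trans (∑-cong (λ x → ℕₚ.*-comm k (f x)) xs) (trans (∑-*ʳ f k xs) (ℕₚ.*-comm (∑ f xs) k))

∑-comm : (h : A → B → ℕ) (xs : List A) (ys : List B) →
         ∑ (λ x → ∑ (h x) ys) xs ≡ ∑ (λ y → ∑ (λ x → h x y) xs) ys
∑-comm h []       ys = sym (∑-zero ys)
∑-comm h (x ∷ xs) ys = trans (cong (∑ (h x) ys +_) (∑-comm h xs ys))
  (sym (∑-+ (h x) (λ y → ∑ (λ x → h x y) xs) ys))

𝟙 : Dec P → ℕ
𝟙 p? = if does p? then 1 else 0

𝟙-yes : (p? : Dec P) → P → 𝟙 p? ≡ 1
𝟙-yes p? p = cong (λ b → if b then 1 else 0) (dec-true p? p)

𝟙-no : (p? : Dec P) → ¬ P → 𝟙 p? ≡ 0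
𝟙-no p? ¬p = cong (λ b → if b then 1 else 0) (dec-false p? ¬p)

𝟙-cong : P ⇔ Q → (p? : Dec P) (q? : Dec Q) → 𝟙 p? ≡ 𝟙 q?
𝟙-cong P⇔Q p? q? = cong (λ b → if b then 1 else 0) (does-⇔ P⇔Q p? q?)

𝟙-mono : (P → Q) → (p? : Dec P) (q? : Dec Q) → 𝟙 p? ≤ 𝟙 q?
𝟙-mono P→Q (yes p) q? = ℕₚ.≤-reflexive (sym (𝟙-yes q? (P→Q p)))
𝟙-mono P→Q (no _)  q? = z≤n

𝟙≤1 : (p? : Dec P) → 𝟙 p? ≤ 1
𝟙≤1 (yes _) = ℕₚ.≤-refl
𝟙≤1 (no _)  = z≤n

length-filter≡∑𝟙 : {R : A → Set} (R? : ∀ x → Dec (R x)) (xs : List A) →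
                     length (filter R? xs) ≡ ∑ (𝟙 ∘ R?) xs
length-filter≡∑𝟙 R? []       = refl
length-filter≡∑𝟙 R? (x ∷ xs) with R? x
... | yes _ = cong suc (length-filter≡∑𝟙 R? xs)
... | no  _ = length-filter≡∑𝟙 R? xs

module _ (_≟_ : DecidableEquality A) where

  count : A → List A → ℕ
  count x = ∑ (λ y → 𝟙 (x ≟ y))

  𝟙-≡-dec-∷ : (x y : A) (u v : List A) →
              𝟙 (≡-dec _≟_ (x ∷ u) (y ∷ v)) ≡ 𝟙 (x ≟ y) * 𝟙 (≡-dec _≟_ u v)
  𝟙-≡-dec-∷ x y u v = by-cases (x ≟ y) (≡-dec _≟_ u v)
    where
    by-cases : (x≟y : Dec (x ≡ y)) (u≟v : Dec (u ≡ v)) →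
               𝟙 (≡-dec _≟_ (x ∷ u) (y ∷ v)) ≡ 𝟙 x≟y * 𝟙 u≟v
    by-cases (yes refl) (yes refl) = 𝟙-yes (≡-dec _≟_ (x ∷ u) (x ∷ u)) refl
    by-cases (yes refl) (no u≢v)   = 𝟙-no (≡-dec _≟_ (x ∷ u) (x ∷ v)) (u≢v ∘ ∷-injectiveʳ)
    by-cases (no x≢y)   _          = 𝟙-no (≡-dec _≟_ (x ∷ u) (y ∷ v)) (x≢y ∘ ∷-injectiveˡ)

  count⇒∈ : (x : A) (xs : List A) → 1 ≤ count x xs → x ∈ xs
  count⇒∈ x (y ∷ xs) pos with x ≟ y
  ... | yes x≡y = here x≡y
  ... | no  _   = there (count⇒∈ x xs pos)

  ∈⇒count : {x : A} {xs : List A} → x ∈ xs → 1 ≤ count x xs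
  ∈⇒count {x} (here refl) = ℕₚ.≤-trans (ℕₚ.≤-reflexive (sym (𝟙-yes (x ≟ x) refl))) (ℕₚ.m≤m+n _ _)
  ∈⇒count {x} {y ∷ _} (there x∈xs) = ℕₚ.≤-trans (∈⇒count x∈xs) (ℕₚ.m≤n+m _ (𝟙 (x ≟ y)))

  count-∉ : {x : A} {xs : List A} → All (x ≢_) xs → count x xs ≡ 0
  count-∉ []                     = refl
  count-∉ {x} {y ∷ _} (x≢y ∷ ne) = cong₂ _+_ (𝟙-no (x ≟ y) x≢y) (count-∉ ne)

  𝟙-≟-sym : (x y : A) → 𝟙 (x ≟ y) ≡ 𝟙 (y ≟ x)
  𝟙-≟-sym x y = 𝟙-cong (mk⇔ sym sym) (x ≟ y) (y ≟ x)

  count-filter : {R : A → Set} (R? : ∀ x → Dec (R x)) {x : A} →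
                 R x → (xs : List A) → count x (filter R? xs) ≡ count x xs
  count-filter R? Rx []       = refl
  count-filter R? {x} Rx (y ∷ xs) with R? y
  ... | yes _  = cong (𝟙 (x ≟ y) +_) (count-filter R? Rx xs)
  ... | no ¬Ry = trans (count-filter R? Rx xs) (sym (cong (_+ _) (𝟙-no (x ≟ y) (λ { refl → ¬Ry Rx }))))

  ∑-update : (x : A) {f g : A → ℕ} (xs : List A) → count x xs ≡ 1 →
             All (λ y → x ≢ y → f y ≡ g y) xs → ∑ f xs + g x ≡ ∑ g xs + f x
  ∑-update x {f} {g} xs once agree = begin
    ∑ f xs + g x               ≡⟨ cong (∑ f xs +_) (sym (ℕₚ.*-identityˡ (g x))) ⟩
    ∑ f xs + 1 * g x           ≡⟨ cong (λ c → ∑ f xs + c * g x) (sym once) ⟩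
    ∑ f xs + count x xs * g x  ≡⟨ weighted xs agree ⟩
    ∑ g xs + count x xs * f x  ≡⟨ cong (λ c → ∑ g xs + c * f x) once ⟩
    ∑ g xs + 1 * f x           ≡⟨ cong (∑ g xs +_) (ℕₚ.*-identityˡ (f x)) ⟩
    ∑ g xs + f x               ∎
    where
    open ≡-Reasoning
    weighted : (ys : List A) → All (λ y → x ≢ y → f y ≡ g y) ys →
               ∑ f ys + count x ys * g x ≡ ∑ g ys + count x ys * f x
    weighted []       []           = refl
    weighted (y ∷ ys) (fy≡gy ∷ rest) with x ≟ y | weighted ys rest
    ... | yes refl | ih = begin
      (f x + F) + (1 + C) * g x   ≡⟨ solve 4 (λ fx gx F C → (fx :+ F) :+ (con 1 :+ C) :* gx
                                              := gx :+ (F :+ C :* gx) :+ fx) refl (f x) (g x) F C ⟩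
      g x + (F + C * g x) + f x   ≡⟨ cong (λ s → g x + s + f x) ih ⟩
      g x + (G + C * f x) + f x   ≡⟨ solve 4 (λ fx gx G C → gx :+ (G :+ C :* fx) :+ fx
                                              := (gx :+ G) :+ (con 1 :+ C) :* fx) refl (f x) (g x) G C ⟩
      (g x + G) + (1 + C) * f x   ∎
      where F = ∑ f ys; G = ∑ g ys; C = count x ys
    ... | no x≢y | ih = begin
      (f y + ∑ f ys) + count x ys * g x  ≡⟨ ℕₚ.+-assoc (f y) _ _ ⟩
      f y + (∑ f ys + count x ys * g x)  ≡⟨ cong₂ _+_ (fy≡gy x≢y) ih ⟩
      g y + (∑ g ys + count x ys * f x)  ≡⟨ ℕₚ.+-assoc (g y) _ _ ⟨
      (g y + ∑ g ys) + count x ys * f x  ∎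

-- Fractions

-- frac a 0 is the junk value 0ℚ: the lemmas below take denominators of the form suc d,
-- or a proof that the denominator is positive.
frac≃mkℚᵘ : ∀ a d → ℚ.toℚᵘ (frac a (suc d)) ℚᵘ.≃ mkℚᵘ (ℤ.+ a) d
frac≃mkℚᵘ a d = ℚₚ.toℚᵘ-fromℚᵘ (mkℚᵘ (ℤ.+ a) d)

frac-cong : ∀ {a p b q} → a * suc q ≡ b * suc p → frac a (suc p) ≡ frac b (suc q)
frac-cong {a} {p} {b} {q} cross = ℚₚ.toℚᵘ-injective (ℚᵘₚ.≃-trans (frac≃mkℚᵘ a p)
  (ℚᵘₚ.≃-trans (*≡* (trans (sym (ℤₚ.pos-* a (suc q))) (trans (cong ℤ.+_ cross) (ℤₚ.pos-* b (suc p)))))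
               (ℚᵘₚ.≃-sym (frac≃mkℚᵘ b q))))

frac-+ : ∀ a p b q → frac a (suc p) +ℚ frac b (suc q) ≡ frac (a * suc q + b * suc p) (suc p * suc q)
frac-+ a p b q = ℚₚ.toℚᵘ-injective (ℚᵘₚ.≃-trans (ℚₚ.toℚᵘ-homo-+ (frac a (suc p)) (frac b (suc q)))
  (ℚᵘₚ.≃-trans (ℚᵘₚ.+-cong (frac≃mkℚᵘ a p) (frac≃mkℚᵘ b q))
  (ℚᵘₚ.≃-trans (ℚᵘₚ.≃-reflexive (cong (λ n → mkℚᵘ n _) numerator))
               (ℚᵘₚ.≃-sym (frac≃mkℚᵘ _ _)))))
  where
  numerator : ℤ.+ a ℤ.* ℤ.+ suc q ℤ.+ ℤ.+ b ℤ.* ℤ.+ suc p ≡ ℤ.+ (a * suc q + b * suc p)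
  numerator = trans (cong₂ ℤ._+_ (sym (ℤₚ.pos-* a (suc q))) (sym (ℤₚ.pos-* b (suc p))))
                    (sym (ℤₚ.pos-+ (a * suc q) (b * suc p)))

frac-* : ∀ a p b q → frac a (suc p) *ℚ frac b (suc q) ≡ frac (a * b) (suc p * suc q)
frac-* a p b q = ℚₚ.toℚᵘ-injective (ℚᵘₚ.≃-trans (ℚₚ.toℚᵘ-homo-* (frac a (suc p)) (frac b (suc q)))
  (ℚᵘₚ.≃-trans (ℚᵘₚ.*-cong (frac≃mkℚᵘ a p) (frac≃mkℚᵘ b q))
  (ℚᵘₚ.≃-trans (ℚᵘₚ.≃-reflexive (cong (λ n → mkℚᵘ n _) (sym (ℤₚ.pos-* a b))))
               (ℚᵘₚ.≃-sym (frac≃mkℚᵘ _ _)))))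

frac-mono-≤ : ∀ {a P b Q} → 0 < P → 0 < Q → a * Q ≤ b * P → frac a P ≤ℚ frac b Q
frac-mono-≤ {a} {suc p} {b} {suc q} (s≤s z≤n) (s≤s z≤n) cross =
  ℚₚ.toℚᵘ-cancel-≤ (ℚᵘₚ.≤-respˡ-≃ (ℚᵘₚ.≃-sym (frac≃mkℚᵘ a p))
  (ℚᵘₚ.≤-respʳ-≃ (ℚᵘₚ.≃-sym (frac≃mkℚᵘ b q))
  (*≤* (subst₂ ℤ._≤_ (ℤₚ.pos-* a (suc q)) (ℤₚ.pos-* b (suc p)) (ℤ.+≤+ cross)))))

frac-zero : ∀ d → frac 0 d ≡ 0ℚ
frac-zero zero    = refl
frac-zero (suc d) = ℚₚ.0/n≡0 (suc d)

∣frac∣ : ∀ a d → ∣ frac a (suc d) ∣ ≡ frac a (suc d)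
∣frac∣ a d = ℚₚ.0≤p⇒∣p∣≡p (ℚₚ.nonNegative⁻¹ (frac a (suc d)) {{ℚₚ.normalize-nonNeg a (suc d)}})

∣p-q∣≡∣q-p∣ : ∀ p q → ∣ p -ℚ q ∣ ≡ ∣ q -ℚ p ∣
∣p-q∣≡∣q-p∣ p q = trans (sym (ℚₚ.∣-p∣≡∣p∣ (p -ℚ q))) (cong ∣_∣ (ℚ-group.⁻¹-anti-homo-// p q))

∣frac-frac∣-≥ : ∀ a {P} b {Q} → 0 < P → 0 < Q → b * P ≤ a * Q →
                ∣ frac a P -ℚ frac b Q ∣ ≡ frac ∣ a * Q - b * P ∣ (P * Q)
∣frac-frac∣-≥ a {P@(suc p)} b {Q@(suc q)} (s≤s z≤n) (s≤s z≤n) bP≤aQ = begin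
  ∣ frac a P -ℚ frac b Q ∣                     ≡⟨ cong (λ x → ∣ x -ℚ frac b Q ∣) split ⟩
  ∣ (frac k (P * Q) +ℚ frac b Q) -ℚ frac b Q ∣ ≡⟨ cong ∣_∣ (ℚ-group.//-rightDividesʳ (frac b Q) (frac k (P * Q))) ⟩
  ∣ frac k (P * Q) ∣                           ≡⟨ ∣frac∣ k _ ⟩
  frac k (P * Q)                               ≡⟨ cong (λ k → frac k (P * Q)) (ℕₚ.m≤n⇒∣n-m∣≡n∸m bP≤aQ) ⟨
  frac ∣ a * Q - b * P ∣ (P * Q)               ∎
  where
  open ≡-Reasoning
  k = a * Q ∸ b * P
  cross : a * (P * Q * Q) ≡ (k * Q + b * (P * Q)) * P
  cross = begin
    a * (P * Q * Q)
      ≡⟨ solve 3 (λ a p q → a :* ((con 1 :+ p) :* (con 1 :+ q) :* (con 1 :+ q))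
                         := a :* (con 1 :+ q) :* ((con 1 :+ p) :* (con 1 :+ q))) refl a p q ⟩
    a * Q * (P * Q)
      ≡⟨ cong (_* (P * Q)) (ℕₚ.m+[n∸m]≡n bP≤aQ) ⟨
    (b * P + k) * (P * Q)
      ≡⟨ solve 4 (λ b k p q → (b :* (con 1 :+ p) :+ k) :* ((con 1 :+ p) :* (con 1 :+ q))
                           := (k :* (con 1 :+ q) :+ b :* ((con 1 :+ p) :* (con 1 :+ q))) :* (con 1 :+ p))
                 refl b k p q ⟩
    (k * Q + b * (P * Q)) * P  ∎
  split : frac a P ≡ frac k (P * Q) +ℚ frac b Q
  split = trans (frac-cong {a} {p} {k * Q + b * (P * Q)} cross) (sym (frac-+ k (q + p * Q) b q))

∣frac-frac∣ : ∀ a {P} b {Q} → 0 < P → 0 < Q → ∣ frac a P -ℚ frac b Q ∣ ≡ frac ∣ a * Q - b * P ∣ (P * Q)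
∣frac-frac∣ a {P} b {Q} P>0 Q>0 with ℕₚ.≤-total (b * P) (a * Q)
... | inj₁ bP≤aQ = ∣frac-frac∣-≥ a b P>0 Q>0 bP≤aQ
... | inj₂ aQ≤bP = begin
  ∣ frac a P -ℚ frac b Q ∣       ≡⟨ ∣p-q∣≡∣q-p∣ (frac a P) (frac b Q) ⟩
  ∣ frac b Q -ℚ frac a P ∣       ≡⟨ ∣frac-frac∣-≥ b a Q>0 P>0 aQ≤bP ⟩
  frac ∣ b * P - a * Q ∣ (Q * P) ≡⟨ cong₂ frac (ℕₚ.∣-∣-comm (b * P) (a * Q)) (ℕₚ.*-comm Q P) ⟩
  frac ∣ a * Q - b * P ∣ (P * Q) ∎
  where open ≡-Reasoning

sumℚ-frac : (f : A → ℕ) {M : ℕ} → 0 < M → (xs : List A) →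
            sumℚ (map (λ x → frac (f x) M) xs) ≡ frac (∑ f xs) M
sumℚ-frac f {M} _ [] = sym (frac-zero M)
sumℚ-frac f {suc m} M>0 (x ∷ xs) = begin
  frac (f x) M +ℚ sumℚ (map (λ x → frac (f x) M) xs)
    ≡⟨ cong (frac (f x) M +ℚ_) (sumℚ-frac f M>0 xs) ⟩
  frac (f x) M +ℚ frac (∑ f xs) M
    ≡⟨ frac-+ (f x) m (∑ f xs) m ⟩
  frac (f x * M + ∑ f xs * M) (M * M)
    ≡⟨ frac-cong {f x * M + ∑ f xs * M} {m + m * M} {f x + ∑ f xs} {m} cross ⟩
  frac (f x + ∑ f xs) M ∎
  where
  open ≡-Reasoning
  M = suc m
  cross : (f x * M + ∑ f xs * M) * M ≡ (f x + ∑ f xs) * (M * M)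
  cross = solve 3 (λ a b m → (a :* (con 1 :+ m) :+ b :* (con 1 :+ m)) :* (con 1 :+ m)
                             := (a :+ b) :* ((con 1 :+ m) :* (con 1 :+ m))) refl (f x) (∑ f xs) m

½*frac-double : ∀ k {M} → 0 < M → ½ *ℚ frac (2 * k) M ≡ frac k M
½*frac-double k {suc m} (s≤s z≤n) = trans (frac-* 1 1 (2 * k) m)
  (frac-cong {1 * (2 * k)} {m + 1 * suc m} {k} {m}
    (solve 2 (λ k m → (con 1 :* (con 2 :* k)) :* (con 1 :+ m) := k :* (con 2 :* (con 1 :+ m))) refl k m))

-- Intervals and increasing lists

interval : ℕ → ℕ → List ℕ
interval i zero    = []
interval i (suc m) = i ∷ interval (suc i) m

Within : ℕ → ℕ → ℕ → Set
Within i m y = i ≤ y × y < i + m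

Within-suc : ∀ {i m y} → Within (suc i) m y → Within i (suc m) y
Within-suc {i} {m} {y} (i<y , y<) = ℕₚ.<⇒≤ i<y , subst (y <_) (sym (ℕₚ.+-suc i m)) y<

Within-pred : ∀ {i m y} → Within i (suc m) y → i ≢ y → Within (suc i) m y
Within-pred {i} {m} {y} (i≤y , y<) i≢y = ℕₚ.≤∧≢⇒< i≤y i≢y , subst (y <_) (ℕₚ.+-suc i m) y<

Within-start : ∀ i m → Within i (suc m) i
Within-start i m = ℕₚ.≤-refl , ℕₚ.m<m+n i (s≤s z≤n)

Within-empty : ∀ {i y} → ¬ Within i 0 y
Within-empty {i} (i≤y , y<) = ℕₚ.<⇒≱ (subst (_ <_) (ℕₚ.+-identityʳ i) y<) i≤y

length-interval : ∀ i m → length (interval i m) ≡ m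
length-interval i zero    = refl
length-interval i (suc m) = cong suc (length-interval (suc i) m)

interval-Within : ∀ i m → All (Within i m) (interval i m)
interval-Within i zero    = []
interval-Within i (suc m) = Within-start i m ∷ All.map Within-suc (interval-Within (suc i) m)

Within⇒∈interval : ∀ {i m y} → Within i m y → y ∈ interval i m
Within⇒∈interval {i} {zero}  w = ⊥-elim (Within-empty w)
Within⇒∈interval {i} {suc m} {y} w with i ℕ.≟ y
... | yes refl = here refl
... | no  i≢y  = there (Within⇒∈interval {suc i} {m} (Within-pred w i≢y))

count-interval : ∀ {i m y} → Within i m y → count ℕ._≟_ y (interval i m) ≡ 1
count-interval {i} {zero}  w = ⊥-elim (Within-empty w)
count-interval {i} {suc m} {y} w with y ℕ.≟ i
... | yes refl = cong₂ _+_ (𝟙-yes (i ℕ.≟ i) refl)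
                    (count-∉ ℕ._≟_ (All.map (λ i<j i≡j → ℕₚ.<-irrefl i≡j (proj₁ i<j))
                                            (interval-Within (suc i) m)))
... | no  y≢i  = cong₂ _+_ (𝟙-no (y ℕ.≟ i) y≢i) (count-interval {suc i} {m} (Within-pred w (y≢i ∘ sym)))

interval-increasing : ∀ i m → Linked _<_ (interval i m)
interval-increasing i zero          = []
interval-increasing i (suc zero)    = [-]
interval-increasing i (suc (suc m)) = ℕₚ.≤-refl ∷ interval-increasing (suc i) (suc m)

range≡interval : ∀ n → range n ≡ interval 1 n
range≡interval n = trans (map-upTo suc n) (shifted suc 1 n (λ _ → refl))
  where
  shifted : ∀ f i m → (∀ k → f k ≡ i + k) → applyUpTo f m ≡ interval i m
  shifted f i zero    f≗ = refl
  shifted f i (suc m) f≗ = cong₂ _∷_ (trans (f≗ 0) (ℕₚ.+-identityʳ i))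
    (shifted (f ∘ suc) (suc i) m (λ k → trans (f≗ (suc k)) (ℕₚ.+-suc i k)))

increasing-∷ : ∀ {x l} → All (x <_) l → Linked _<_ l → Linked _<_ (x ∷ l)
increasing-∷ []          _   = [-]
increasing-∷ (x<y ∷ _)   inc = x<y ∷ inc

increasing⇒head< : ∀ {x l} → Linked _<_ (x ∷ l) → All (x <_) l
increasing⇒head< [-]          = []
increasing⇒head< (x<y ∷ inc) = Linked⇒All ℕₚ.<-trans x<y inc

Within-pred-All : ∀ {i m s} → All (Within i (suc m)) s → All (i <_) s → All (Within (suc i) m) s
Within-pred-All s-in above = All.zipWith (λ (y-in , i<y) → Within-pred y-in (ℕₚ.<⇒≢ i<y)) (s-in , above)

-- R is arbitrary so that the suffix of a Grassmannian permutation is cut out by non-membership in its prefix.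
filter-interval : ∀ {R : ℕ → Set} (R? : ∀ j → Dec (R j)) {i m s} → Linked _<_ s → All (Within i m) s →
                  (∀ {j} → Within i m j → R j ⇔ j ∈ s) → filter R? (interval i m) ≡ s
filter-interval R? {m = zero}  {[]}    _ _          _ = refl
filter-interval R? {m = zero}  {_ ∷ _} _ (x-in ∷ _) _ = ⊥-elim (Within-empty x-in)
filter-interval R? {i} {suc m} {[]} _ _ agree =
  trans (filter-reject R? (λ Ri → contradiction (Equivalence.to (agree (Within-start i m)) Ri) λ ()))
        (filter-interval R? [] [] (agree ∘ Within-suc))
filter-interval {R} R? {i} {suc m} {x ∷ s} inc (x-in ∷ s-in) agree with i ℕ.≟ x
... | yes refl = trans (filter-accept R? (Equivalence.from (agree (Within-start i m)) (here refl)))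
                       (cong (i ∷_) (filter-interval R? (Linked.tail inc) (Within-pred-All s-in above) agree′))
  where
  above = increasing⇒head< inc
  agree′ : ∀ {j} → Within (suc i) m j → R j ⇔ j ∈ s
  agree′ {j} j-in = mk⇔ (λ Rj → drop-head (Equivalence.to (agree (Within-suc j-in)) Rj))
                        (λ j∈s → Equivalence.from (agree (Within-suc j-in)) (there j∈s))
    where
    drop-head : j ∈ i ∷ s → j ∈ s
    drop-head (here refl) = ⊥-elim (ℕₚ.<-irrefl refl (proj₁ j-in))
    drop-head (there j∈s) = j∈s
... | no i≢x =
  trans (filter-reject R? (λ Ri → ℕₚ.<-irrefl refl (All.lookup above′ (Equivalence.to (agree (Within-start i m)) Ri))))
        (filter-interval R? inc (Within-pred-All (x-in ∷ s-in) above′) (agree ∘ Within-suc))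
  where
  i<x = ℕₚ.≤∧≢⇒< (proj₁ x-in) i≢x
  above′ : All (i <_) (x ∷ s)
  above′ = i<x ∷ All.map (ℕₚ.<-trans i<x) (increasing⇒head< inc)

increasing-Within⇒interval : ∀ {i m s} → Linked _<_ s → length s ≡ m → All (Within i m) s → s ≡ interval i m
increasing-Within⇒interval {i} {zero}  {[]}    _   _   _              = refl
increasing-Within⇒interval {i} {suc m} {x ∷ s} inc |s| (x-in ∷ s-in) = cong₂ _∷_ x≡i s≡
  where
  above = increasing⇒head< inc
  s≡ : s ≡ interval (suc i) m
  s≡ = increasing-Within⇒interval (Linked.tail inc) (ℕₚ.suc-injective |s|)
         (Within-pred-All s-in (All.map (ℕₚ.≤-<-trans (proj₁ x-in)) above))
  x<1+i : ∀ {m s} → x < i + suc m → All (x <_) s → s ≡ interval (suc i) m → x < suc i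
  x<1+i {zero}  x< _           _    = subst (x <_) (ℕₚ.+-comm i 1) x<
  x<1+i {suc _} _  (x<1+i ∷ _) refl = x<1+i
  x≡i : x ≡ i
  x≡i = ℕₚ.≤-antisym (ℕₚ.≤-pred (x<1+i (proj₂ x-in) above s≡)) (proj₁ x-in)

-- Words, subsets and permutations

_≟ₗ_ : DecidableEquality (List ℕ)
_≟ₗ_ = ≡-dec ℕ._≟_

_≟ᵇ_ : DecidableEquality (List Bool)
_≟ᵇ_ = ≡-dec Bool._≟_

All-words : ∀ k xs {R : List ℕ → Set} →
            (∀ w → length w ≡ k → All (_∈ xs) w → R w) → All R (words k xs)
All-words zero    xs R-words = R-words [] refl [] ∷ []
All-words (suc k) xs R-words = All.concat⁺ (All.map⁺ (All.tabulate (λ {x} x∈xs →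
  All.map⁺ (All-words k xs (λ w |w| w⊆xs → R-words (x ∷ w) (cong suc |w|) (x∈xs ∷ w⊆xs))))))

count-words : ∀ k xs w → length w ≡ k → All (λ y → count ℕ._≟_ y xs ≡ 1) w →
              count _≟ₗ_ w (words k xs) ≡ 1
count-words zero    xs []      refl []             = refl
count-words (suc k) xs (y ∷ w) |w|  (once ∷ onces) = begin
  ∑ (λ v → 𝟙 ((y ∷ w) ≟ₗ v)) (concat (map extend xs))
    ≡⟨ ∑-concat _ (map extend xs) ⟩
  ∑ (∑ (λ v → 𝟙 ((y ∷ w) ≟ₗ v))) (map extend xs)
    ≡⟨ ∑-map _ extend xs ⟩
  ∑ (λ x → ∑ (λ v → 𝟙 ((y ∷ w) ≟ₗ v)) (map (x ∷_) W)) xs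
    ≡⟨ ∑-cong (λ x → ∑-map _ (x ∷_) W) xs ⟩
  ∑ (λ x → ∑ (λ v → 𝟙 ((y ∷ w) ≟ₗ (x ∷ v))) W) xs
    ≡⟨ ∑-cong (λ x → ∑-cong (λ v → 𝟙-≡-dec-∷ ℕ._≟_ y x w v) W) xs ⟩
  ∑ (λ x → ∑ (λ v → 𝟙 (y ℕ.≟ x) * 𝟙 (w ≟ₗ v)) W) xs
    ≡⟨ ∑-cong (λ x → ∑-*ˡ (𝟙 (y ℕ.≟ x)) _ W) xs ⟩
  ∑ (λ x → 𝟙 (y ℕ.≟ x) * count _≟ₗ_ w W) xs
    ≡⟨ ∑-*ʳ _ (count _≟ₗ_ w W) xs ⟩
  count ℕ._≟_ y xs * count _≟ₗ_ w W
    ≡⟨ cong₂ _*_ once (count-words k xs w (ℕₚ.suc-injective |w|) onces) ⟩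
  1 ∎
  where
  open ≡-Reasoning
  W = words k xs
  extend = λ x → map (x ∷_) W

∑-subsets-suc : ∀ n (f : List Bool → ℕ) →
                ∑ f (subsets (suc n)) ≡ ∑ (f ∘ (true ∷_)) (subsets n) + ∑ (f ∘ (false ∷_)) (subsets n)
∑-subsets-suc n f = begin
  ∑ f (concat (map (λ b → map (b ∷_) (subsets n)) (true ∷ false ∷ [])))
    ≡⟨ ∑-concat f (map (λ b → map (b ∷_) (subsets n)) (true ∷ false ∷ [])) ⟩
  ∑ f (map (true ∷_) (subsets n)) + (∑ f (map (false ∷_) (subsets n)) + 0)
    ≡⟨ cong₂ _+_ (∑-map f (true ∷_) (subsets n)) (trans (ℕₚ.+-identityʳ _) (∑-map f (false ∷_) (subsets n))) ⟩
  ∑ (f ∘ (true ∷_)) (subsets n) + ∑ (f ∘ (false ∷_)) (subsets n) ∎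
  where open ≡-Reasoning

subsets-length : ∀ n → All (λ V → length V ≡ n) (subsets n)
subsets-length zero    = refl ∷ []
subsets-length (suc n) = All.concat⁺ (prefixed true ∷ prefixed false ∷ [])
  where
  prefixed : ∀ b → All (λ V → length V ≡ suc n) (map (b ∷_) (subsets n))
  prefixed b = All.map⁺ (All.map (cong suc) (subsets-length n))

∑1-subsets : ∀ n → ∑ (λ _ → 1) (subsets n) ≡ 2 ^ n
∑1-subsets zero    = refl
∑1-subsets (suc n) = begin
  ∑ (λ _ → 1) (subsets (suc n))  ≡⟨ ∑-subsets-suc n (λ _ → 1) ⟩
  S + S                          ≡⟨ cong (λ k → k + k) (∑1-subsets n) ⟩
  2 ^ n + 2 ^ n                  ≡⟨ cong (2 ^ n +_) (ℕₚ.+-identityʳ (2 ^ n)) ⟨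
  2 ^ suc n                      ∎
  where
  open ≡-Reasoning
  S = ∑ (λ _ → 1) (subsets n)

count-subsets : ∀ n r → count _≟ᵇ_ r (subsets n) ≡ 𝟙 (length r ℕ.≟ n)
count-subsets zero    []      = refl
count-subsets zero    (_ ∷ _) = refl
count-subsets (suc n) []      = begin
  count _≟ᵇ_ [] (subsets (suc n))  ≡⟨ ∑-subsets-suc n _ ⟩
  ∑ (λ _ → 0) S + ∑ (λ _ → 0) S    ≡⟨ cong₂ _+_ (∑-zero S) (∑-zero S) ⟩
  0                                ∎
  where
  open ≡-Reasoning
  S = subsets n
count-subsets (suc n) (b ∷ r) = begin
  count _≟ᵇ_ (b ∷ r) (subsets (suc n))
    ≡⟨ ∑-subsets-suc n _ ⟩
  ∑ (λ V → 𝟙 ((b ∷ r) ≟ᵇ (true ∷ V))) S + ∑ (λ V → 𝟙 ((b ∷ r) ≟ᵇ (false ∷ V))) S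
    ≡⟨ cong₂ _+_ (∑-cong (𝟙-≡-dec-∷ Bool._≟_ b true r) S) (∑-cong (𝟙-≡-dec-∷ Bool._≟_ b false r) S) ⟩
  ∑ (λ V → 𝟙 (b Bool.≟ true) * 𝟙 (r ≟ᵇ V)) S + ∑ (λ V → 𝟙 (b Bool.≟ false) * 𝟙 (r ≟ᵇ V)) S
    ≡⟨ cong₂ _+_ (∑-*ˡ (𝟙 (b Bool.≟ true)) _ S) (∑-*ˡ (𝟙 (b Bool.≟ false)) _ S) ⟩
  𝟙 (b Bool.≟ true) * count _≟ᵇ_ r S + 𝟙 (b Bool.≟ false) * count _≟ᵇ_ r S
    ≡⟨ cong (λ c → 𝟙 (b Bool.≟ true) * c + 𝟙 (b Bool.≟ false) * c) (count-subsets n r) ⟩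
  𝟙 (b Bool.≟ true) * 𝟙 (length r ℕ.≟ n) + 𝟙 (b Bool.≟ false) * 𝟙 (length r ℕ.≟ n)
    ≡⟨ one-of b (𝟙 (length r ℕ.≟ n)) ⟩
  𝟙 (length r ℕ.≟ n) ∎
  where
  open ≡-Reasoning
  S = subsets n
  one-of : ∀ b k → 𝟙 (b Bool.≟ true) * k + 𝟙 (b Bool.≟ false) * k ≡ k
  one-of true  k = trans (ℕₚ.+-identityʳ (k + 0)) (ℕₚ.+-identityʳ k)
  one-of false k = ℕₚ.+-identityʳ k

IsPermutation : ℕ → List ℕ → Set
IsPermutation n w = length w ≡ n × All (Within 1 n) w × IsPerm n w

Within⇒∈range : ∀ {n y} → Within 1 n y → y ∈ range n
Within⇒∈range {n} w = subst (_ ∈_) (sym (range≡interval n)) (Within⇒∈interval w)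

∈range⇒Within : ∀ {n y} → y ∈ range n → Within 1 n y
∈range⇒Within {n} y∈ = All.lookup (interval-Within 1 n) (subst (_ ∈_) (range≡interval n) y∈)

Sn-permutations : ∀ n → All (IsPermutation n) (Sn n)
Sn-permutations n = All.zipWith (λ (covers , |w| , bounded) → |w| , bounded , covers)
  (All.all-filter (isPerm? n) W , All.filter⁺ (isPerm? n)
    (All-words n (range n) (λ w |w| w⊆ → |w| , All.map ∈range⇒Within w⊆)))
  where W = words n (range n)

count-Sn : ∀ n {w} → IsPermutation n w → count _≟ₗ_ w (Sn n) ≡ 1
count-Sn n {w} (|w| , bounded , covers) = trans (count-filter _≟ₗ_ (isPerm? n) covers (words n (range n)))
  (count-words n (range n) w |w| (All.map once bounded))
  where
  once : ∀ {y} → Within 1 n y → count ℕ._≟_ y (range n) ≡ 1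
  once {y} y-in = trans (cong (count ℕ._≟_ y) (range≡interval n)) (count-interval y-in)

Distinct : List ℕ → Set
Distinct w = ∀ j → count ℕ._≟_ j w ≤ 1

∑-count-interval : ∀ {i m} w → All (Within i m) w →
                   ∑ (λ j → count ℕ._≟_ j w) (interval i m) ≡ length w
∑-count-interval {i} {m} []      []               = ∑-zero (interval i m)
∑-count-interval {i} {m} (x ∷ w) (x-in ∷ w-in) = begin
  ∑ (λ j → 𝟙 (j ℕ.≟ x) + count ℕ._≟_ j w) I
    ≡⟨ ∑-+ _ _ I ⟩
  ∑ (λ j → 𝟙 (j ℕ.≟ x)) I + ∑ (λ j → count ℕ._≟_ j w) I
    ≡⟨ cong₂ _+_ (∑-cong (λ j → 𝟙-≟-sym ℕ._≟_ j x) I) (∑-count-interval w w-in) ⟩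
  count ℕ._≟_ x I + length w
    ≡⟨ cong (_+ length w) (count-interval x-in) ⟩
  suc (length w) ∎
  where
  open ≡-Reasoning
  I = interval i m

∑≡length⇒all-1 : (f : A → ℕ) {xs : List A} → All (λ x → 1 ≤ f x) xs → ∑ f xs ≡ length xs →
                 All (λ x → f x ≡ 1) xs
∑≡length⇒all-1 f {[]}     []           _   = []
∑≡length⇒all-1 f {x ∷ xs} (fx≥1 ∷ pos) sum = fx≡1 ∷ ∑≡length⇒all-1 f pos rest
  where
  length≤∑ : ∀ {ys} → All (λ y → 1 ≤ f y) ys → length ys ≤ ∑ f ys
  length≤∑ []         = z≤n
  length≤∑ (p ∷ ps) = ℕₚ.+-mono-≤ p (length≤∑ ps)
  fx≤1 : f x ≤ 1
  fx≤1 = ℕₚ.+-cancelʳ-≤ (length xs) (f x) 1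
           (ℕₚ.≤-trans (ℕₚ.+-monoʳ-≤ (f x) (length≤∑ pos)) (ℕₚ.≤-reflexive sum))
  fx≡1 : f x ≡ 1
  fx≡1 = ℕₚ.≤-antisym fx≤1 fx≥1
  rest : ∑ f xs ≡ length xs
  rest = ℕₚ.+-cancelˡ-≡ 1 _ _ (trans (cong (_+ ∑ f xs) (sym fx≡1)) sum)

permutation-distinct : ∀ {n w} → IsPermutation n w → Distinct w
permutation-distinct {n} {w} (|w| , bounded , covers) j with (1 ℕ.≤? j) ×-dec (j ℕ.<? 1 + n)
... | yes j-in = ℕₚ.≤-reflexive (All.lookup all-once (Within⇒∈interval j-in))
  where
  all-once : All (λ j → count ℕ._≟_ j w ≡ 1) (interval 1 n)
  all-once = ∑≡length⇒all-1 (λ j → count ℕ._≟_ j w)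
    (All.map (λ j-in → ∈⇒count ℕ._≟_ (All.lookup covers (Within⇒∈range j-in))) (interval-Within 1 n))
    (trans (∑-count-interval w bounded) (trans |w| (sym (length-interval 1 n))))
... | no j-out =
  ℕₚ.≤-trans (ℕₚ.≤-reflexive (count-∉ ℕ._≟_ (All.map (λ x-in → j-out ∘ λ { refl → x-in }) bounded))) z≤n

-- Descents

≤⇒≮ᵇ : ∀ {m n} → n ≤ m → (m <ᵇ n) ≡ false
≤⇒≮ᵇ {m} {n} n≤m with m <ᵇ n in eq
... | false = refl
... | true  = contradiction (ℕₚ.<ᵇ⇒< m n (subst T (sym eq) _)) (ℕₚ.≤⇒≯ n≤m)

≮ᵇ⇒≤ : ∀ {m n} → (m <ᵇ n) ≡ false → n ≤ m
≮ᵇ⇒≤ {m} {n} eq = ℕₚ.≮⇒≥ (λ m<n → subst T eq (ℕₚ.<⇒<ᵇ m<n))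

des-∷∷≡0 : ∀ {x y r} → des (x ∷ y ∷ r) ≡ 0 → (y <ᵇ x) ≡ false × des (y ∷ r) ≡ 0
des-∷∷≡0 {x} {y} d with y <ᵇ x | d
... | false | d′ = refl , d′

des-∷ : ∀ x w → des (x ∷ w) ≤ suc (des w)
des-∷ x []      = z≤n
des-∷ x (y ∷ w) = ℕₚ.+-monoˡ-≤ (des (y ∷ w)) (descent≤1 (y <ᵇ x))
  where
  descent≤1 : ∀ b → (if b then 1 else 0) ≤ 1
  descent≤1 true  = ℕₚ.≤-refl
  descent≤1 false = z≤n

des-++ : ∀ ys zs → des (ys ++ zs) ≤ des ys + suc (des zs)
des-++ []          zs = ℕₚ.n≤1+n (des zs)
des-++ (x ∷ [])    zs = des-∷ x zs
des-++ (x ∷ y ∷ r) zs = ℕₚ.≤-trans (ℕₚ.+-monoʳ-≤ (if y <ᵇ x then 1 else 0) (des-++ (y ∷ r) zs))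
                                   (ℕₚ.≤-reflexive (sym (ℕₚ.+-assoc (if y <ᵇ x then 1 else 0) (des (y ∷ r)) _)))

increasing⇒des≡0 : ∀ {w} → Linked _<_ w → des w ≡ 0
increasing⇒des≡0 []                       = refl
increasing⇒des≡0 [-]                      = refl
increasing⇒des≡0 {x ∷ y ∷ _} (x<y ∷ rest) =
  cong₂ (λ b d → (if b then 1 else 0) + d) (≤⇒≮ᵇ (ℕₚ.<⇒≤ x<y)) (increasing⇒des≡0 rest)

Distinct-tail : ∀ {x w} → Distinct (x ∷ w) → Distinct w
Distinct-tail {x} {w} distinct j = ℕₚ.≤-trans (ℕₚ.m≤n+m (count ℕ._≟_ j w) (𝟙 (j ℕ.≟ x))) (distinct j)

des≡0⇒increasing : ∀ {w} → des w ≡ 0 → Distinct w → Linked _<_ w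
des≡0⇒increasing {[]}        _ _ = []
des≡0⇒increasing {x ∷ []}    _ _ = [-]
des≡0⇒increasing {x ∷ y ∷ r} d distinct =
  ℕₚ.≤∧≢⇒< (≮ᵇ⇒≤ (proj₁ d′)) x≢y ∷ des≡0⇒increasing (proj₂ d′) (Distinct-tail {x} {y ∷ r} distinct)
  where
  d′ : (y <ᵇ x) ≡ false × des (y ∷ r) ≡ 0
  d′ = des-∷∷≡0 {x} {y} {r} d
  x≢y : x ≢ y
  x≢y refl = ℕₚ.<⇒≱ (s≤s (s≤s z≤n)) (ℕₚ.≤-trans twice (distinct x))
    where
    twice : 2 ≤ count ℕ._≟_ x (x ∷ x ∷ r)
    twice rewrite 𝟙-yes (x ℕ.≟ x) refl = s≤s (s≤s z≤n)

splitAtDescent : List ℕ → List ℕ × List ℕ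
splitAtDescent []          = [] , []
splitAtDescent (x ∷ [])    = x ∷ [] , []
splitAtDescent (x ∷ y ∷ r) =
  if y <ᵇ x then (x ∷ [] , y ∷ r) else Product.map₁ (x ∷_) (splitAtDescent (y ∷ r))

prefix : List ℕ → List ℕ
prefix = proj₁ ∘ splitAtDescent

suffix : List ℕ → List ℕ
suffix = proj₂ ∘ splitAtDescent

prefix++suffix : ∀ w → prefix w ++ suffix w ≡ w
prefix++suffix []            = refl
prefix++suffix (x ∷ [])      = refl
prefix++suffix (x ∷ w@(y ∷ r)) with y <ᵇ x | prefix++suffix w
... | true  | _  = refl
... | false | ih = cong (x ∷_) ih

prefix-head : ∀ y r → ∃ λ t → prefix (y ∷ r) ≡ y ∷ t
prefix-head y []      = [] , refl
prefix-head y (z ∷ r) with z <ᵇ y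
... | true  = [] , refl
... | false = prefix (z ∷ r) , refl

des-prefix : ∀ w → des (prefix w) ≡ 0
des-prefix []              = refl
des-prefix (x ∷ [])        = refl
des-prefix (x ∷ w@(y ∷ r)) with prefix-head y r | des-prefix w
... | t , p≡y∷t | ih with y <ᵇ x in y≮x
...   | true  = refl
...   | false rewrite p≡y∷t | y≮x = ih

des-suffix : ∀ w → des w ≤ 1 → des (suffix w) ≡ 0
des-suffix []              _ = refl
des-suffix (x ∷ [])        _ = refl
des-suffix (x ∷ w@(y ∷ r)) d with y <ᵇ x | des-suffix w
... | true  | _  = ℕₚ.n≤0⇒n≡0 (ℕₚ.≤-pred d)
... | false | ih = ih d

splitAtDescent-++ : ∀ ys zs → des ys ≡ 0 → des zs ≡ 0 →
                    splitAtDescent (ys ++ zs) ≡ (ys , zs) ⊎ des (ys ++ zs) ≡ 0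
splitAtDescent-++ []          zs      _  dzs = inj₂ dzs
splitAtDescent-++ (x ∷ [])    []      _  _   = inj₁ refl
splitAtDescent-++ (x ∷ [])    (z ∷ r) _  dzs with z <ᵇ x
... | true  = inj₁ refl
... | false = inj₂ dzs
splitAtDescent-++ (x ∷ w@(y ∷ r)) zs dys dzs
  with des-∷∷≡0 {x} {y} {r} dys | splitAtDescent-++ w zs (proj₂ (des-∷∷≡0 {x} {y} {r} dys)) dzs
... | y≮x , _ | ih rewrite y≮x with ih
...   | inj₁ split≡ = inj₁ (cong (Product.map₁ (x ∷_)) split≡)
...   | inj₂ d      = inj₂ d

-- The sampling map V ↦ grassOf V

chosen unchosen : ℕ → List Bool → List ℕ
chosen   i V = proj₁ (selectFrom i V)
unchosen i V = proj₂ (selectFrom i V)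

-- grassFrom 1 V is definitionally grassOf V.
grassFrom : ℕ → List Bool → List ℕ
grassFrom i V = chosen i V ++ unchosen i V

length-grassFrom : ∀ i V → length (grassFrom i V) ≡ length V
length-grassFrom i []          = refl
length-grassFrom i (true ∷ V)  = cong suc (length-grassFrom (suc i) V)
length-grassFrom i (false ∷ V) = begin
  length (Y ++ i ∷ Z)         ≡⟨ length-++ Y ⟩
  length Y + suc (length Z)   ≡⟨ ℕₚ.+-suc (length Y) (length Z) ⟩
  suc (length Y + length Z)   ≡⟨ cong suc (length-++ Y) ⟨
  suc (length (Y ++ Z))       ≡⟨ cong suc (length-grassFrom (suc i) V) ⟩
  suc (length V)              ∎
  where
  open ≡-Reasoning
  Y = chosen (suc i) V
  Z = unchosen (suc i) V

chosen-Within : ∀ i V → All (Within i (length V)) (chosen i V)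
chosen-Within i []          = []
chosen-Within i (true ∷ V)  = Within-start i (length V) ∷ All.map Within-suc (chosen-Within (suc i) V)
chosen-Within i (false ∷ V) = All.map Within-suc (chosen-Within (suc i) V)

unchosen-Within : ∀ i V → All (Within i (length V)) (unchosen i V)
unchosen-Within i []          = []
unchosen-Within i (true ∷ V)  = All.map Within-suc (unchosen-Within (suc i) V)
unchosen-Within i (false ∷ V) = Within-start i (length V) ∷ All.map Within-suc (unchosen-Within (suc i) V)

chosen-increasing : ∀ i V → Linked _<_ (chosen i V)
chosen-increasing i []          = []
chosen-increasing i (true ∷ V)  = increasing-∷ (All.map proj₁ (chosen-Within (suc i) V)) (chosen-increasing (suc i) V)
chosen-increasing i (false ∷ V) = chosen-increasing (suc i) V

unchosen-increasing : ∀ i V → Linked _<_ (unchosen i V)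
unchosen-increasing i []          = []
unchosen-increasing i (true ∷ V)  = unchosen-increasing (suc i) V
unchosen-increasing i (false ∷ V) = increasing-∷ (All.map proj₁ (unchosen-Within (suc i) V)) (unchosen-increasing (suc i) V)

grassFrom-covers : ∀ i V {j} → Within i (length V) j → j ∈ grassFrom i V
grassFrom-covers i []          j-in = ⊥-elim (Within-empty j-in)
grassFrom-covers i (true ∷ V) {j} j-in with i ℕ.≟ j
... | yes refl = here refl
... | no  i≢j  = there (grassFrom-covers (suc i) V (Within-pred j-in i≢j))
grassFrom-covers i (false ∷ V) {j} j-in with i ℕ.≟ j
... | yes refl = ∈-++⁺ʳ (chosen (suc i) V) (here refl)
... | no  i≢j  with ∈-++⁻ (chosen (suc i) V) (grassFrom-covers (suc i) V (Within-pred j-in i≢j))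
...   | inj₁ j∈Y = ∈-++⁺ˡ j∈Y
...   | inj₂ j∈Z = ∈-++⁺ʳ (chosen (suc i) V) (there j∈Z)

indicator-chosen : ∀ i V → map (λ j → does (j ∈? chosen i V)) (interval i (length V)) ≡ V
indicator-chosen i []          = refl
indicator-chosen i (true ∷ V)  = cong₂ _∷_ (dec-true (i ∈? i ∷ chosen (suc i) V) (here refl))
  (trans (map-cong-local (All.map (λ j-in → does-⇔ (mk⇔ (∈-tail j-in) there) (_ ∈? _) (_ ∈? chosen (suc i) V))
                                  (interval-Within (suc i) (length V))))
         (indicator-chosen (suc i) V))
  where
  ∈-tail : ∀ {j} → Within (suc i) (length V) j → j ∈ i ∷ chosen (suc i) V → j ∈ chosen (suc i) V
  ∈-tail (i<j , _) (here refl) = ⊥-elim (ℕₚ.<-irrefl refl i<j)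
  ∈-tail _         (there j∈)  = j∈
indicator-chosen i (false ∷ V) = cong₂ _∷_ (dec-false (i ∈? chosen (suc i) V)
    (λ i∈ → ℕₚ.<-irrefl refl (proj₁ (All.lookup (chosen-Within (suc i) V) i∈))))
  (indicator-chosen (suc i) V)

selectFrom-allFalse : ∀ i m → selectFrom i (replicate m false) ≡ ([] , interval i m)
selectFrom-allFalse i zero    = refl
selectFrom-allFalse i (suc m) rewrite selectFrom-allFalse (suc i) m = refl

selectFrom-indicator : ∀ {R : ℕ → Set} (R? : ∀ j → Dec (R j)) i m →
  selectFrom i (map (does ∘ R?) (interval i m)) ≡ (filter R? (interval i m) , filter (∁? R?) (interval i m))
selectFrom-indicator R? i zero    = refl
selectFrom-indicator R? i (suc m) rewrite selectFrom-indicator R? (suc i) m with R? i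
... | yes _ = refl
... | no  _ = refl

count-grassFrom-interval : ∀ i m → ∑ (λ V → 𝟙 (grassFrom i V ≟ₗ interval i m)) (subsets m) ≡ suc m
count-grassFrom-interval i zero    = refl
count-grassFrom-interval i (suc m) = begin
  ∑ (λ V → 𝟙 (grassFrom i V ≟ₗ interval i (suc m))) (subsets (suc m))
    ≡⟨ ∑-subsets-suc m _ ⟩
  ∑ (λ V → 𝟙 ((i ∷ grassFrom (suc i) V) ≟ₗ (i ∷ I))) S + ∑ (λ V → 𝟙 (grassFrom i (false ∷ V) ≟ₗ (i ∷ I))) S
    ≡⟨ cong₂ _+_ (∑-cong head-i S) (∑-cong-All (All.map 𝟙-only-allFalse (subsets-length m))) ⟩
  ∑ (λ V → 1 * 𝟙 (grassFrom (suc i) V ≟ₗ I)) S + count _≟ᵇ_ (replicate m false) S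
    ≡⟨ cong₂ _+_ (trans (∑-cong (λ V → ℕₚ.*-identityˡ _) S) (count-grassFrom-interval (suc i) m))
                 (trans (count-subsets m (replicate m false))
                        (𝟙-yes (length (replicate m false) ℕ.≟ m) (length-replicate m))) ⟩
  suc m + 1
    ≡⟨ ℕₚ.+-comm (suc m) 1 ⟩
  suc (suc m) ∎
  where
  open ≡-Reasoning
  S = subsets m
  I = interval (suc i) m
  head-i : ∀ V → 𝟙 ((i ∷ grassFrom (suc i) V) ≟ₗ (i ∷ I)) ≡ 1 * 𝟙 (grassFrom (suc i) V ≟ₗ I)
  head-i V = trans (𝟙-≡-dec-∷ ℕ._≟_ i i (grassFrom (suc i) V) I)
                   (cong (_* 𝟙 (grassFrom (suc i) V ≟ₗ I)) (𝟙-yes (i ℕ.≟ i) refl))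
  no-chosen : ∀ {V} → grassFrom i (false ∷ V) ≡ i ∷ I → chosen (suc i) V ≡ []
  no-chosen {V} eq with chosen (suc i) V | chosen-Within (suc i) V
  ... | []    | _              = refl
  ... | _ ∷ _ | (i<y , _) ∷ _ = ⊥-elim (ℕₚ.<-irrefl (sym (∷-injectiveˡ eq)) i<y)
  map-false : ∀ j k → map (λ _ → false) (interval j k) ≡ replicate k false
  map-false j zero    = refl
  map-false j (suc k) = cong (false ∷_) (map-false (suc j) k)
  only-allFalse : ∀ {V} → length V ≡ m → grassFrom i (false ∷ V) ≡ i ∷ I ⇔ replicate m false ≡ V
  only-allFalse {V} |V| = mk⇔
    (λ eq → begin
      replicate m false                                               ≡⟨ cong (λ k → replicate k false) |V| ⟨
      replicate (length V) false                                      ≡⟨ map-false (suc i) (length V) ⟨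
      map (λ j → does (j ∈? [])) (interval (suc i) (length V))
        ≡⟨ cong (λ Y → map (λ j → does (j ∈? Y)) (interval (suc i) (length V))) (no-chosen {V} eq) ⟨
      map (λ j → does (j ∈? chosen (suc i) V)) (interval (suc i) (length V)) ≡⟨ indicator-chosen (suc i) V ⟩
      V                                                               ∎)
    (λ allFalse → subst (λ V → grassFrom i (false ∷ V) ≡ i ∷ I) allFalse
                        (cong (λ p → proj₁ p ++ i ∷ proj₂ p) (selectFrom-allFalse (suc i) m)))

  𝟙-only-allFalse : ∀ {V} → length V ≡ m →
                    𝟙 (grassFrom i (false ∷ V) ≟ₗ (i ∷ I)) ≡ 𝟙 (replicate m false ≟ᵇ V)
  𝟙-only-allFalse {V} |V| =
    𝟙-cong (only-allFalse {V} |V|) (grassFrom i (false ∷ V) ≟ₗ (i ∷ I)) (replicate m false ≟ᵇ V)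
identity : ℕ → List ℕ
identity n = interval 1 n

mult : ℕ → List ℕ → ℕ
mult n w = ∑ (λ V → 𝟙 (grassOf V ≟ₗ w)) (subsets n)

grassOf-permutation : ∀ {n V} → length V ≡ n → IsPermutation n (grassOf V)
grassOf-permutation {V = V} refl =
  length-grassFrom 1 V ,
  All.++⁺ (chosen-Within 1 V) (unchosen-Within 1 V) ,
  All.tabulate (λ j∈ → grassFrom-covers 1 V (∈range⇒Within j∈))

des-grassOf : ∀ V → des (grassOf V) ≤ 1
des-grassOf V = ℕₚ.≤-trans (des-++ (chosen 1 V) (unchosen 1 V))
  (ℕₚ.≤-reflexive (cong₂ (λ a b → a + suc b) (increasing⇒des≡0 (chosen-increasing 1 V))
                                             (increasing⇒des≡0 (unchosen-increasing 1 V))))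

mult-identity : ∀ n → mult n (identity n) ≡ suc n
mult-identity n = count-grassFrom-interval 1 n

toSubset : ℕ → List ℕ → List Bool
toSubset n w = map (λ j → does (j ∈? prefix w)) (identity n)

-- Either the descent of grassOf V sits between its chosen and unchosen values,
-- or grassOf V is increasing and hence the identity.
toSubset-grassOf : ∀ {n V} → length V ≡ n → grassOf V ≢ identity n → toSubset n (grassOf V) ≡ V
toSubset-grassOf {n} {V} refl ≢id
  with splitAtDescent-++ (chosen 1 V) (unchosen 1 V)
         (increasing⇒des≡0 (chosen-increasing 1 V)) (increasing⇒des≡0 (unchosen-increasing 1 V))
... | inj₁ split≡ rewrite split≡ = indicator-chosen 1 V
... | inj₂ des≡0 = ⊥-elim (≢id (increasing-Within⇒interval
        (des≡0⇒increasing des≡0 (permutation-distinct perm)) (proj₁ perm) (proj₁ (proj₂ perm))))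
  where perm = grassOf-permutation {V = V} refl

grassOf-toSubset : ∀ {n w} → IsPermutation n w → des w ≤ 1 → grassOf (toSubset n w) ≡ w
grassOf-toSubset {n} {w} perm@(_ , bounded , covers) d = begin
  grassOf (toSubset n w)
    ≡⟨ cong (λ p → proj₁ p ++ proj₂ p) (selectFrom-indicator (_∈? a) 1 n) ⟩
  filter (_∈? a) (identity n) ++ filter (∁? (_∈? a)) (identity n)
    ≡⟨ cong₂ _++_ (filter-interval (_∈? a) a-inc a-in (λ _ → mk⇔ (λ x → x) (λ x → x)))
                  (filter-interval (∁? (_∈? a)) b-inc b-in (λ j-in → mk⇔ (∉a⇒∈b j-in) ∈b⇒∉a)) ⟩
  a ++ b
    ≡⟨ prefix++suffix w ⟩
  w ∎
  where
  open ≡-Reasoning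
  a = prefix w
  b = suffix w
  ab-bounded : All (Within 1 n) (a ++ b)
  ab-bounded = subst (All (Within 1 n)) (sym (prefix++suffix w)) bounded
  a-in = proj₁ (All.++⁻ a ab-bounded)
  b-in = proj₂ (All.++⁻ a ab-bounded)
  split-counts : ∀ j → count ℕ._≟_ j a + count ℕ._≟_ j b ≤ 1
  split-counts j = subst (_≤ 1) (trans (cong (count ℕ._≟_ j) (sym (prefix++suffix w))) (∑-++ _ a b))
                         (permutation-distinct perm j)
  a-inc = des≡0⇒increasing (des-prefix w) (λ j → ℕₚ.≤-trans (ℕₚ.m≤m+n _ _) (split-counts j))
  b-inc = des≡0⇒increasing (des-suffix w d) (λ j → ℕₚ.≤-trans (ℕₚ.m≤n+m _ _) (split-counts j))
  ∈b⇒∉a : ∀ {j} → j ∈ b → j ∉ a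
  ∈b⇒∉a {j} j∈b j∈a =
    ℕₚ.<⇒≱ (s≤s (s≤s z≤n)) (ℕₚ.≤-trans (ℕₚ.+-mono-≤ (∈⇒count ℕ._≟_ j∈a) (∈⇒count ℕ._≟_ j∈b)) (split-counts j))
  ∉a⇒∈b : ∀ {j} → Within 1 n j → j ∉ a → j ∈ b
  ∉a⇒∈b j-in j∉a with ∈-++⁻ a (subst (_ ∈_) (sym (prefix++suffix w)) (All.lookup covers (Within⇒∈range j-in)))
  ... | inj₁ j∈a = ⊥-elim (j∉a j∈a)
  ... | inj₂ j∈b = j∈b

mult≤1 : ∀ {n w} → w ≢ identity n → mult n w ≤ 1
mult≤1 {n} {w} ≢id = ℕₚ.≤-trans
  (∑-mono-All {xs = subsets n}
    (All.map (λ {V} |V| → 𝟙-mono (λ { refl → toSubset-grassOf {V = V} |V| ≢id }) (grassOf V ≟ₗ w) (toSubset n w ≟ᵇ V))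
             (subsets-length n)))
  (ℕₚ.≤-trans (ℕₚ.≤-reflexive (count-subsets n (toSubset n w))) (𝟙≤1 (length (toSubset n w) ℕ.≟ n)))

grassmannian⇒1≤mult : ∀ {n w} → IsPermutation n w → des w ≤ 1 → 1 ≤ mult n w
grassmannian⇒1≤mult {n} {w} perm d = ℕₚ.≤-trans
  (ℕₚ.≤-reflexive (sym (trans (count-subsets n (toSubset n w)) (𝟙-yes (length (toSubset n w) ℕ.≟ n) |toSubset|))))
  (∑-mono-All {xs = subsets n}
    (All.tabulate (λ {V} _ → 𝟙-mono (λ { refl → grassOf-toSubset perm d }) (toSubset n w ≟ᵇ V) (grassOf V ≟ₗ w))))
  where
  |toSubset| : length (toSubset n w) ≡ n
  |toSubset| = trans (length-map _ (identity n)) (length-interval 1 n)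

1≤mult⇒grassmannian : ∀ {n w} → 1 ≤ mult n w → des w ≤ 1
1≤mult⇒grassmannian {n} {w} = go (subsets n)
  where
  go : ∀ Vs → 1 ≤ ∑ (λ V → 𝟙 (grassOf V ≟ₗ w)) Vs → des w ≤ 1
  go (V ∷ Vs) pos with grassOf V ≟ₗ w
  ... | yes refl = des-grassOf V
  ... | no  _    = go Vs pos

mult-grassmannian : ∀ {n w} → IsPermutation n w → w ≢ identity n → mult n w ≡ 𝟙 (grass? w)
mult-grassmannian {n} {w} perm ≢id = by-cases (grass? w)
  where
  by-cases : Dec (des w ≤ 1) → mult n w ≡ 𝟙 (grass? w)
  by-cases (yes d) = trans (ℕₚ.≤-antisym (mult≤1 ≢id) (grassmannian⇒1≤mult perm d)) (sym (𝟙-yes (grass? w) d))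
  by-cases (no ¬d) = trans (ℕₚ.n≤0⇒n≡0 (ℕₚ.≮⇒≥ (¬d ∘ 1≤mult⇒grassmannian {n}))) (sym (𝟙-no (grass? w) ¬d))

∑-mult : ∀ n → ∑ (mult n) (Sn n) ≡ 2 ^ n
∑-mult n = begin
  ∑ (λ w → ∑ (λ V → 𝟙 (grassOf V ≟ₗ w)) (subsets n)) (Sn n)
    ≡⟨ ∑-comm (λ w V → 𝟙 (grassOf V ≟ₗ w)) (Sn n) (subsets n) ⟩
  ∑ (λ V → count _≟ₗ_ (grassOf V) (Sn n)) (subsets n)
    ≡⟨ ∑-cong-All (All.map (λ {V} |V| → count-Sn n (grassOf-permutation {V = V} |V|)) (subsets-length n)) ⟩
  ∑ (λ _ → 1) (subsets n)
    ≡⟨ ∑1-subsets n ⟩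
  2 ^ n ∎
  where open ≡-Reasoning

identity-permutation : ∀ n → IsPermutation n (identity n)
identity-permutation n = length-interval 1 n , interval-Within 1 n , All.tabulate (Within⇒∈interval ∘ ∈range⇒Within)

identity-grassmannian : ∀ n → des (identity n) ≤ 1
identity-grassmannian n = ℕₚ.≤-trans (ℕₚ.≤-reflexive (increasing⇒des≡0 (interval-increasing 1 n))) z≤n

2^n≡|Gn|+n : ∀ n → 2 ^ n ≡ length (Gn n) + n
2^n≡|Gn|+n n = ℕₚ.+-cancelʳ-≡ 1 _ _ (begin
  2 ^ n + 1
    ≡⟨ cong₂ _+_ (∑-mult n) (𝟙-yes (grass? (identity n)) (identity-grassmannian n)) ⟨
  ∑ (mult n) (Sn n) + 𝟙 (grass? (identity n))
    ≡⟨ ∑-update _≟ₗ_ (identity n) (Sn n) (count-Sn n (identity-permutation n))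
                 (All.map (λ perm ≢id → mult-grassmannian perm (≢id ∘ sym)) (Sn-permutations n)) ⟩
  ∑ (𝟙 ∘ grass?) (Sn n) + mult n (identity n)
    ≡⟨ cong₂ _+_ (sym (length-filter≡∑𝟙 grass? (Sn n))) (mult-identity n) ⟩
  length (Gn n) + suc n
    ≡⟨ ℕₚ.+-suc (length (Gn n)) n ⟩
  suc (length (Gn n) + n)
    ≡⟨ ℕₚ.+-comm 1 (length (Gn n) + n) ⟩
  length (Gn n) + n + 1 ∎)
  where open ≡-Reasoning

-- The total variation distance

Gdist-mult : ∀ n w → Gdist n w ≡ frac (mult n w) (2 ^ n)
Gdist-mult n w = cong (λ k → frac k (2 ^ n)) (length-filter≡∑𝟙 (λ V → grassOf V ≟ₗ w) (subsets n))

Unif-perm : ∀ {n w} → IsPermutation n w → Unif n w ≡ frac (𝟙 (grass? w)) (length (Gn n))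
Unif-perm {n} {w} perm with Any.any? (λ v → v ≟ₗ w) (Gn n)
... | yes w∈Gn = cong (λ k → frac k (length (Gn n))) (sym (𝟙-yes (grass? w) grassmannian))
  where
  grassmannian : des w ≤ 1
  grassmannian = proj₂ (∈-filter⁻ grass? {xs = Sn n} (Any.map sym w∈Gn))
... | no  w∉Gn = sym (trans (cong (λ k → frac k (length (Gn n))) (𝟙-no (grass? w) not-grassmannian))
                           (frac-zero (length (Gn n))))
  where
  w∈Sn : w ∈ Sn n
  w∈Sn = count⇒∈ _≟ₗ_ w (Sn n) (ℕₚ.≤-reflexive (sym (count-Sn n perm)))
  not-grassmannian : ¬ des w ≤ 1
  not-grassmannian d = w∉Gn (Any.map sym (∈-filter⁺ grass? w∈Sn d))

Gn-nonempty : ∀ n → 0 < length (Gn n)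
Gn-nonempty n = nonempty (∈-filter⁺ grass? id∈Sn (identity-grassmannian n))
  where
  id∈Sn : identity n ∈ Sn n
  id∈Sn = count⇒∈ _≟ₗ_ (identity n) (Sn n) (ℕₚ.≤-reflexive (sym (count-Sn n (identity-permutation n))))
  nonempty : ∀ {x} {xs : List (List ℕ)} → x ∈ xs → 0 < length xs
  nonempty {xs = _ ∷ _} _ = s≤s z≤n

-- numerator of |𝔾_n(w) − Unif(w)| over the common denominator 2^n |𝒢_n|
gap : ℕ → List ℕ → ℕ
gap n w = ∣ mult n w * length (Gn n) - 𝟙 (grass? w) * 2 ^ n ∣

∣Gdist-Unif∣ : ∀ {n w} → IsPermutation n w →
               ∣ Gdist n w -ℚ Unif n w ∣ ≡ frac (gap n w) (2 ^ n * length (Gn n))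
∣Gdist-Unif∣ {n} {w} perm = trans (cong₂ (λ x y → ∣ x -ℚ y ∣) (Gdist-mult n w) (Unif-perm perm))
                                  (∣frac-frac∣ (mult n w) (𝟙 (grass? w)) (ℕₚ.m^n>0 2 n) (Gn-nonempty n))

gap-identity : ∀ n → gap n (identity n) ≡ n * (length (Gn n) ∸ 1)
gap-identity n rewrite mult-identity n | 𝟙-yes (grass? (identity n)) (identity-grassmannian n) | 2^n≡|Gn|+n n
  with length (Gn n) | Gn-nonempty n
... | suc N′ | _ = begin
  ∣ suc n * suc N′ - D ∣      ≡⟨ cong ∣_- D ∣ (solve 2 (λ n N → (con 1 :+ n) :* (con 1 :+ N)
                                                         := con 1 :* (con 1 :+ N :+ n) :+ n :* N) refl n N′) ⟩
  ∣ D + n * N′ - D ∣          ≡⟨ ℕₚ.∣-∣-comm (D + n * N′) D ⟩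
  ∣ D - D + n * N′ ∣          ≡⟨ ℕₚ.∣m-m+n∣≡n D (n * N′) ⟩
  n * N′                      ∎
  where
  open ≡-Reasoning
  D = 1 * (suc N′ + n)

gap-other : ∀ {n w} → IsPermutation n w → w ≢ identity n → gap n w ≡ mult n w * n
gap-other {n} {w} perm ≢id rewrite mult-grassmannian perm ≢id | 2^n≡|Gn|+n n = begin
  ∣ g * N - g * (N + n) ∣      ≡⟨ cong (∣ g * N -_∣) (ℕₚ.*-distribˡ-+ g N n) ⟩
  ∣ g * N - g * N + g * n ∣    ≡⟨ ℕₚ.∣m-m+n∣≡n (g * N) (g * n) ⟩
  g * n                        ∎
  where
  open ≡-Reasoning
  g = 𝟙 (grass? w)
  N = length (Gn n)

∑-gap : ∀ n → ∑ (gap n) (Sn n) ≡ 2 * (n * (length (Gn n) ∸ 1))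
∑-gap n = ℕₚ.+-cancelʳ-≡ (suc n * n) _ _ (begin
  ∑ (gap n) (Sn n) + suc n * n
    ≡⟨ cong (λ c → ∑ (gap n) (Sn n) + c * n) (mult-identity n) ⟨
  ∑ (gap n) (Sn n) + mult n (identity n) * n
    ≡⟨ ∑-update _≟ₗ_ (identity n) (Sn n) (count-Sn n (identity-permutation n))
                 (All.map (λ perm ≢id → gap-other perm (≢id ∘ sym)) (Sn-permutations n)) ⟩
  ∑ (λ w → mult n w * n) (Sn n) + gap n (identity n)
    ≡⟨ cong₂ _+_ (∑-*ʳ (mult n) n (Sn n)) (gap-identity n) ⟩
  ∑ (mult n) (Sn n) * n + n * (N ∸ 1)
    ≡⟨ cong (λ D → D * n + n * (N ∸ 1)) (trans (∑-mult n) (2^n≡|Gn|+n n)) ⟩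
  (N + n) * n + n * (N ∸ 1)
    ≡⟨ arithmetic N (Gn-nonempty n) ⟩
  2 * (n * (N ∸ 1)) + suc n * n ∎)
  where
  open ≡-Reasoning
  N = length (Gn n)
  arithmetic : ∀ N → 0 < N → (N + n) * n + n * (N ∸ 1) ≡ 2 * (n * (N ∸ 1)) + suc n * n
  arithmetic (suc N′) _ =
    solve 2 (λ n N → (con 1 :+ N :+ n) :* n :+ n :* N := con 2 :* (n :* N) :+ (con 1 :+ n) :* n) refl n N′

TV≡ : ∀ n → TV Gdist Unif n ≡ frac (n * (length (Gn n) ∸ 1)) (2 ^ n * length (Gn n))
TV≡ n = begin
  ½ *ℚ sumℚ (map (λ w → ∣ Gdist n w -ℚ Unif n w ∣) (Sn n))
    ≡⟨ cong (λ ws → ½ *ℚ sumℚ ws) (map-cong-local (All.map ∣Gdist-Unif∣ (Sn-permutations n))) ⟩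
  ½ *ℚ sumℚ (map (λ w → frac (gap n w) M) (Sn n))
    ≡⟨ cong (½ *ℚ_) (sumℚ-frac (gap n) M>0 (Sn n)) ⟩
  ½ *ℚ frac (∑ (gap n) (Sn n)) M
    ≡⟨ cong (λ k → ½ *ℚ frac k M) (∑-gap n) ⟩
  ½ *ℚ frac (2 * (n * (N ∸ 1))) M
    ≡⟨ ½*frac-double (n * (N ∸ 1)) M>0 ⟩
  frac (n * (N ∸ 1)) M ∎
  where
  open ≡-Reasoning
  N = length (Gn n)
  M = 2 ^ n * N
  M>0 : 0 < M
  M>0 = ℕₚ.*-mono-< {0} {2 ^ n} {0} {N} (ℕₚ.m^n>0 2 n) (Gn-nonempty n)

TV≤ : ∀ n → frac (n * (length (Gn n) ∸ 1)) (2 ^ n * length (Gn n)) ≤ℚ frac n (2 ^ n)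
TV≤ n = frac-mono-≤ (ℕₚ.*-mono-< {0} {2 ^ n} {0} {N} (ℕₚ.m^n>0 2 n) (Gn-nonempty n)) (ℕₚ.m^n>0 2 n) (begin
  n * (N ∸ 1) * 2 ^ n    ≤⟨ ℕₚ.*-monoˡ-≤ (2 ^ n) (ℕₚ.*-monoʳ-≤ n (ℕₚ.m∸n≤m N 1)) ⟩
  n * N * 2 ^ n          ≡⟨ solve 3 (λ n N D → n :* N :* D := n :* (D :* N)) refl n N (2 ^ n) ⟩
  n * (2 ^ n * N)        ∎)
  where
  open ℕₚ.≤-Reasoning
  N = length (Gn n)

2^n∸n≡|Gn| : ∀ n → 2 ^ n ∸ n ≡ length (Gn n)
2^n∸n≡|Gn| n = trans (cong (_∸ n) (2^n≡|Gn|+n n)) (ℕₚ.m+n∸n≡m (length (Gn n)) n)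

-- The formula holds for every n.
lemma4p13 : (n : ℕ) → 2 ≤ n →
    (TV Gdist Unif n ≡ frac (n * (2 ^ n ∸ n ∸ 1)) (2 ^ n * (2 ^ n ∸ n)))
    × (frac (n * (2 ^ n ∸ n ∸ 1)) (2 ^ n * (2 ^ n ∸ n)) ≤ℚ frac n (2 ^ n))
lemma4p13 n _ rewrite 2^n∸n≡|Gn| n = TV≡ n , TV≤ n
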